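{- Let $\mathcal I_1,\mathcal I_2$ be compatible IOSAs and $a,b\in\mathcal A^{\mathsf u}$. If both $\mathcal I_1$ and $\mathcal I_2$ are confluent w.r.t. $a$ and $b$, then so is $\mathcal I_1\|\mathcal I_2$. Consequently, if $\mathcal I_1$ and $\mathcal I_2$ are confluent, then $\mathcal I_1\|\mathcal I_2$ is confluent.
   Context: An IOSA is a tuple $\mathcal I=(\mathcal S,\mathcal A,\mathcal C,\rightarrow,C_0,s_0)$ of denumerable states $\mathcal S$, denumerable actions $\mathcal A$ partitioned into inputs $\mathcal A^{\mathsf i}$ and outputs $\mathcal A^{\mathsf o}$ with an urgent subset $\mathcal A^{\mathsf u}$ and a silent action $\tau\in\mathcal A^{\mathsf u}\cap\mathcal A^{\mathsf o}$, a finite set of clocks $\mathcal C$ (each with a continuous probability measure on $\mathbb R$ concentrated on $\mathbb R_{>0}$), transitions $s\xrightarrow{C,a,C'}s'$ ($C,C'\subseteq\mathcal C$), $C_0\subseteq\mathcal C$ and initial state $s_0$, satisfying: (a) $a\in\mathcal A^{\mathsf i}\cup\mathcal A^{\mathsf u}$ implies $C=\emptyset$; (b) $a\in\mathcal A^{\mathsf o}\setminus\mathcal A^{\mathsf u}$ implies $C$ is a singleton; (c) two transitions from the same state with the same singleton clock set have the same action, reset set and target; (d) every input is enabled in every state; (e) inputs are deterministic; (f) there is $\mathrm{active}:\mathcal S\to2^{\mathcal C}$ with $\mathrm{active}(s_0)\subseteq C_0$, $\mathrm{enabling}(s)\subseteq\mathrm{active}(s)$ (where $\mathrm{enabling}(s)$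 is the set of clocks $y$ with some $s\xrightarrow{\{y\},\cdot,\cdot}\cdot$), equality when $s$ is stable (no urgent output transition with empty clock set leaves $s$), and $\mathrm{active}(s)\subseteq(\mathrm{active}(t)\setminus C)\cup C'$ whenever $t\xrightarrow{C,a,C'}s$. Compatibility: $\mathcal A^{\mathsf o}_1\cap\mathcal A^{\mathsf o}_2\subseteq\{\tau\}$, $\mathcal C_1\cap\mathcal C_2=\emptyset$, $\mathcal A_1\cap\mathcal A^{\mathsf u}_2=\mathcal A_2\cap\mathcal A^{\mathsf u}_1$. Composition $\mathcal I_1\|\mathcal I_2$: states $s_1\|s_2$, $\mathcal A^{\mathsf o}=\mathcal A^{\mathsf o}_1\cup\mathcal A^{\mathsf o}_2$, $\mathcal A^{\mathsf i}=(\mathcal A^{\mathsf i}_1\cup\mathcal A^{\mathsf i}_2)\setminus\mathcal A^{\mathsf o}$, $\mathcal A^{\mathsf u}=\mathcal A^{\mathsf u}_1\cup\mathcal A^{\mathsf u}_2$, clocks $\mathcal C_1\cup\mathcal C_2$, transitions by: (R1) $s_1\xrightarrow{C,a,C'}_1s_1'$, $a\in(\mathcal A_1\setminus\mathcal A_2)\cup\{\tau\}$ gives $s_1\|s_2\xrightarrow{C,a,C'}s_1'\|s_2$; (R2) symmetric; (R3) $s_1\xrightarrow{C_1,a,C_1'}_1s_1'$, $s_2\xrightarrow{C_2,a,C_2'}_2s_2'$, $a\in(\mathcal A_1\cap\mathcal A_2)\setminus\{\tau\}$ gives $s_1\|s_2\xrightarrow{C_1\cup C_2,a,C_1'\cup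 C_2'}s_1'\|s_2'$. An IOSA is confluent w.r.t. $a,b\in\mathcal A^{\mathsf u}$ if for every state $s$ and transitions $s\xrightarrow{\emptyset,a,C_1}s_1$, $s\xrightarrow{\emptyset,b,C_2}s_2$ there is a state $s_3$ with $s_1\xrightarrow{\emptyset,b,C_2}s_3$ and $s_2\xrightarrow{\emptyset,a,C_1}s_3$; it is confluent if confluent w.r.t. every pair of urgent actions. -}

module Defs where

open import Data.Bool using (Bool; true; false; _∨_; _∧_; not)
open import Data.Nat using (ℕ)
open import Data.Product using (Σ; _×_; _,_)
open import Data.Sum using (_⊎_)
open import Data.List using (List)
open import Data.List.Membership.Propositional using (_∈_)
open import Relation.Binary.PropositionalEquality using (_≡_)
open import Relation.Nullary using (¬_)
open import Function.Definitions using (Injective)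

-- The whole theory is developed over a fixed universe of action names `Act`
-- (containing the silent action τ) and a fixed universe of clock names `Clk`.
-- Each IOSA selects its (finite) set of clocks and its actions from these.
module IOSATheory (Act : Set) (Clk : Set) (τ : Act) where

  ClkSet : Set
  ClkSet = Clk → Bool

  _∪_ : ClkSet → ClkSet → ClkSet
  (C ∪ D) x = C x ∨ D x

  _∖_ : ClkSet → ClkSet → ClkSet
  (C ∖ D) x = C x ∧ not (D x)

  _⊆_ : ClkSet → ClkSet → Set
  C ⊆ D = ∀ x → C x ≡ true → D x ≡ true

  _≐_ : ClkSet → ClkSet → Set
  C ≐ D = ∀ x → C x ≡ D x

  Empty : ClkSet → Set
  Empty C = ∀ x → C x ≡ false

  Singleton : Clk → ClkSet → Set
  Singleton y C = C y ≡ true × (∀ x → C x ≡ true → x ≡ y)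

  record IOSAData : Set₁ where
    field
      State  : Set
      inp    : Act → Bool
      out    : Act → Bool
      urg    : Act → Bool
      clk    : ClkSet
      Trans  : State → ClkSet → Act → ClkSet → State → Set
               -- Trans s C a C' s'  is  s --C,a,C'--> s'
      C0     : ClkSet
      s0     : State

    acts : Act → Bool
    acts a = inp a ∨ out a

    Enabling : State → Clk → Set
    Enabling s y = Σ ClkSet λ C → Singleton y C × Σ Act λ a → Σ ClkSet λ C' →
                   Σ State λ s' → Trans s C a C' s'

    Stable : State → Set
    Stable s = ¬ (Σ ClkSet λ C → Σ Act λ a → Σ ClkSet λ C' → Σ State λ s' →
                  Empty C × urg a ≡ true × out a ≡ true × Trans s C a C' s')

  record IsIOSA (I : IOSAData) : Set where
    open IOSAData I
    field
      states-denumerable  : Σ (State → ℕ) λ f → Injective _≡_ _≡_ f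
      actions-denumerable : Σ (Σ Act (λ a → acts a ≡ true) → ℕ) λ f → Injective _≡_ _≡_ f
      inp-out-disjoint    : ∀ a → inp a ∧ out a ≡ false
      urg⊆acts            : ∀ a → urg a ≡ true → acts a ≡ true
      τ-urgent            : urg τ ≡ true
      τ-output            : out τ ≡ true
      clocks-finite       : Σ (List Clk) λ l → ∀ x → clk x ≡ true → x ∈ l
      C0⊆clk              : C0 ⊆ clk
      trans-wf            : ∀ {s C a C' s'} → Trans s C a C' s' →
                            C ⊆ clk × C' ⊆ clk × acts a ≡ true
      cond-a : ∀ {s C a C' s'} → Trans s C a C' s' → inp a ∨ urg a ≡ true → Empty C
      cond-b : ∀ {s C a C' s'} → Trans s C a C' s' → out a ≡ true → urg a ≡ false →
               Σ Clk λ y → Singleton y C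
      cond-c : ∀ {s y C a C' s' D b D' s''} → Singleton y C → Singleton y D →
               Trans s C a C' s' → Trans s D b D' s'' →
               a ≡ b × C' ≐ D' × s' ≡ s''
      cond-d : ∀ s a → inp a ≡ true →
               Σ ClkSet λ C → Empty C × Σ ClkSet λ C' → Σ State λ s' → Trans s C a C' s'
      cond-e : ∀ {s a C C' s' D D' s''} → inp a ≡ true →
               Trans s C a C' s' → Trans s D a D' s'' → C' ≐ D' × s' ≡ s''
      cond-f : Σ (State → ClkSet) λ active →
                 active s0 ⊆ C0
               × (∀ s y → Enabling s y → active s y ≡ true)
               × (∀ s → Stable s → ∀ y → active s y ≡ true → Enabling s y)
               × (∀ {t C a C' s} → Trans t C a C' s →
                    active s ⊆ ((active t ∖ C) ∪ C'))

  record Compatible (I₁ I₂ : IOSAData) : Set where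
    module I₁ = IOSAData I₁
    module I₂ = IOSAData I₂
    field
      outputs-disjoint : ∀ a → I₁.out a ∧ I₂.out a ≡ true → a ≡ τ
      clocks-disjoint  : ∀ x → I₁.clk x ∧ I₂.clk x ≡ false
      urgent-agree     : ∀ a → I₁.acts a ∧ I₂.urg a ≡ I₂.acts a ∧ I₁.urg a

  module _ (I₁ I₂ : IOSAData) where
    private
      module I₁ = IOSAData I₁
      module I₂ = IOSAData I₂

    data ParTrans : I₁.State × I₂.State → ClkSet → Act → ClkSet →
                    I₁.State × I₂.State → Set where
      R1 : ∀ {s₁ s₂ C a C' s₁'} → I₁.Trans s₁ C a C' s₁' →
           (I₁.acts a ∧ not (I₂.acts a) ≡ true) ⊎ a ≡ τ →
           ParTrans (s₁ , s₂) C a C' (s₁' , s₂)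
      R2 : ∀ {s₁ s₂ C a C' s₂'} → I₂.Trans s₂ C a C' s₂' →
           (I₂.acts a ∧ not (I₁.acts a) ≡ true) ⊎ a ≡ τ →
           ParTrans (s₁ , s₂) C a C' (s₁ , s₂')
      R3 : ∀ {s₁ s₂ C₁ C₂ a C₁' C₂' s₁' s₂'} →
           I₁.Trans s₁ C₁ a C₁' s₁' → I₂.Trans s₂ C₂ a C₂' s₂' →
           I₁.acts a ∧ I₂.acts a ≡ true → ¬ a ≡ τ →
           ParTrans (s₁ , s₂) (C₁ ∪ C₂) a (C₁' ∪ C₂') (s₁' , s₂')

    _∥_ : IOSAData
    _∥_ = record
      { State = I₁.State × I₂.State
      ; inp   = λ a → (I₁.inp a ∨ I₂.inp a) ∧ not (I₁.out a ∨ I₂.out a)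
      ; out   = λ a → I₁.out a ∨ I₂.out a
      ; urg   = λ a → I₁.urg a ∨ I₂.urg a
      ; clk   = I₁.clk ∪ I₂.clk
      ; Trans = ParTrans
      ; C0    = I₁.C0 ∪ I₂.C0
      ; s0    = I₁.s0 , I₂.s0
      }

  ConfluentWrt : IOSAData → Act → Act → Set
  ConfluentWrt I a b =
    ∀ {s E₁ C₁ s₁ E₂ C₂ s₂} → Empty E₁ → Empty E₂ →
      Trans s E₁ a C₁ s₁ → Trans s E₂ b C₂ s₂ →
      Σ State λ s₃ →
          (Σ ClkSet λ E → Empty E × Trans s₁ E b C₂ s₃)
        × (Σ ClkSet λ E → Empty E × Trans s₂ E a C₁ s₃)
    where open IOSAData I

  Confluent : IOSAData → Set
  Confluent I = ∀ a b → IOSAData.urg I a ≡ true → IOSAData.urg I b ≡ true →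
                ConfluentWrt I a b

-- A pair of diverging urgent steps of I₁ ∥ I₂ is closed componentwise: steps of
-- different components commute outright, and steps of the same component are closed by
-- that component's confluence (for a synchronised step, in both components at once).  For full confluence the only
-- extra point is that an action urgent in the composition and known to one component is
-- urgent in that component, which is the compatibility condition on urgent actions.
module Submission where

open import Defs
open import Data.Bool using (Bool; true; false; _∨_; _∧_)
open import Data.Bool.Properties using (∧-zeroʳ; ∨-comm; ∨-conicalˡ; ∨-conicalʳ)
open import Data.Product using (_×_; _,_; proj₂)
open import Relation.Binary.PropositionalEquality using (_≡_; refl; sym; trans)

urgent-agreement⇒urgent : ∀ {x u v y : Bool} →
  x ≡ true → x ∧ u ≡ y ∧ v → v ∨ u ≡ true → v ≡ true
urgent-agreement⇒urgent {v = true}  _    _ _    = refl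
urgent-agreement⇒urgent {v = false} {y} refl e refl with () ← trans e (∧-zeroʳ y)

module Confluence (Act Clk : Set) (τ : Act) where
  open IOSATheory Act Clk τ

  Empty-∪⁻ˡ : ∀ {C D} → Empty (C ∪ D) → Empty C
  Empty-∪⁻ˡ e x = ∨-conicalˡ _ _ (e x)

  Empty-∪⁻ʳ : ∀ {C D} → Empty (C ∪ D) → Empty D
  Empty-∪⁻ʳ e x = ∨-conicalʳ _ _ (e x)

  Empty-∪ : ∀ {C D} → Empty C → Empty D → Empty (C ∪ D)
  Empty-∪ {C} {D} e f x rewrite e x | f x = refl

  module _ (I₁ I₂ : IOSAData) where
    private
      module I₁ = IOSAData I₁
      module I₂ = IOSAData I₂

    ∥-confluentWrt : ∀ {a b} → ConfluentWrt I₁ a b → ConfluentWrt I₂ a b →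
                     ConfluentWrt (I₁ ∥ I₂) a b
    ∥-confluentWrt c₁ c₂ e₁ e₂ (R1 t₁ p) (R1 u₁ q) with c₁ e₁ e₂ t₁ u₁
    ... | _ , (_ , f , v) , (_ , g , w) = _ , (_ , f , R1 v q) , (_ , g , R1 w p)
    ∥-confluentWrt c₁ c₂ e₁ e₂ (R1 t₁ p) (R2 u₂ q) =
      _ , (_ , e₂ , R2 u₂ q) , (_ , e₁ , R1 t₁ p)
    ∥-confluentWrt c₁ c₂ e₁ e₂ (R2 t₂ p) (R1 u₁ q) =
      _ , (_ , e₂ , R1 u₁ q) , (_ , e₁ , R2 t₂ p)
    ∥-confluentWrt c₁ c₂ e₁ e₂ (R2 t₂ p) (R2 u₂ q) with c₂ e₁ e₂ t₂ u₂
    ... | _ , (_ , f , v) , (_ , g , w) = _ , (_ , f , R2 v q) , (_ , g , R2 w p)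
    ∥-confluentWrt c₁ c₂ e₁ e₂ (R1 t₁ p) (R3 u₁ u₂ h n) with c₁ e₁ (Empty-∪⁻ˡ e₂) t₁ u₁
    ... | _ , (_ , f , v) , (_ , g , w) =
      _ , (_ , Empty-∪ f (Empty-∪⁻ʳ e₂) , R3 v u₂ h n) , (_ , g , R1 w p)
    ∥-confluentWrt c₁ c₂ e₁ e₂ (R2 t₂ p) (R3 u₁ u₂ h n) with c₂ e₁ (Empty-∪⁻ʳ e₂) t₂ u₂
    ... | _ , (_ , f , v) , (_ , g , w) =
      _ , (_ , Empty-∪ (Empty-∪⁻ˡ e₂) f , R3 u₁ v h n) , (_ , g , R2 w p)
    ∥-confluentWrt c₁ c₂ e₁ e₂ (R3 t₁ t₂ h n) (R1 u₁ q) with c₁ (Empty-∪⁻ˡ e₁) e₂ t₁ u₁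
    ... | _ , (_ , f , v) , (_ , g , w) =
      _ , (_ , f , R1 v q) , (_ , Empty-∪ g (Empty-∪⁻ʳ e₁) , R3 w t₂ h n)
    ∥-confluentWrt c₁ c₂ e₁ e₂ (R3 t₁ t₂ h n) (R2 u₂ q) with c₂ (Empty-∪⁻ʳ e₁) e₂ t₂ u₂
    ... | _ , (_ , f , v) , (_ , g , w) =
      _ , (_ , f , R2 v q) , (_ , Empty-∪ (Empty-∪⁻ˡ e₁) g , R3 t₁ w h n)
    ∥-confluentWrt c₁ c₂ e₁ e₂ (R3 t₁ t₂ h n) (R3 u₁ u₂ h′ n′)
      with c₁ (Empty-∪⁻ˡ e₁) (Empty-∪⁻ˡ e₂) t₁ u₁ | c₂ (Empty-∪⁻ʳ e₁) (Empty-∪⁻ʳ e₂) t₂ u₂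
    ... | _ , (_ , f₁ , v₁) , (_ , g₁ , w₁) | _ , (_ , f₂ , v₂) , (_ , g₂ , w₂) =
      _ , (_ , Empty-∪ f₁ f₂ , R3 v₁ v₂ h′ n′) , (_ , Empty-∪ g₁ g₂ , R3 w₁ w₂ h n)

    module _ (K : Compatible I₁ I₂) where
      open Compatible K using (urgent-agree)

      urgent-∥⇒urgentˡ : ∀ {a} → I₁.urg a ∨ I₂.urg a ≡ true →
                         I₁.acts a ≡ true → I₁.urg a ≡ true
      urgent-∥⇒urgentˡ {a} u ac = urgent-agreement⇒urgent ac (urgent-agree a) u

      urgent-∥⇒urgentʳ : ∀ {a} → I₁.urg a ∨ I₂.urg a ≡ true →
                         I₂.acts a ≡ true → I₂.urg a ≡ true
      urgent-∥⇒urgentʳ {a} u ac =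
        urgent-agreement⇒urgent ac (sym (urgent-agree a)) (trans (∨-comm (I₂.urg a) _) u)

  -- Transitions only carry actions of I, so urgency matters only for those.
  confluent⇒confluentWrt : ∀ {I} → IsIOSA I → Confluent I → ∀ {a b} →
    let open IOSAData I in
    (acts a ≡ true → urg a ≡ true) → (acts b ≡ true → urg b ≡ true) → ConfluentWrt I a b
  confluent⇒confluentWrt {I} W c {a} {b} ua ub e₁ e₂ t u =
    c a b (ua (label-action t)) (ub (label-action u)) e₁ e₂ t u
    where
      open IOSAData I
      label-action : ∀ {s C x C′ s′} → Trans s C x C′ s′ → acts x ≡ true
      label-action t = proj₂ (proj₂ (IsIOSA.trans-wf W t))

proposition2 : (Act Clk : Set) (τ : Act) → let open IOSATheory Act Clk τ in
    (I₁ I₂ : IOSAData) → IsIOSA I₁ → IsIOSA I₂ → Compatible I₁ I₂ →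
      ((a b : Act) → IOSAData.urg I₁ a ∨ IOSAData.urg I₂ a ≡ true →
         IOSAData.urg I₁ b ∨ IOSAData.urg I₂ b ≡ true →
         ConfluentWrt I₁ a b → ConfluentWrt I₂ a b → ConfluentWrt (I₁ ∥ I₂) a b)
      × (Confluent I₁ → Confluent I₂ → Confluent (I₁ ∥ I₂))
proposition2 Act Clk τ I₁ I₂ W₁ W₂ K =
  (λ _ _ _ _ → ∥-confluentWrt I₁ I₂) ,
  λ c₁ c₂ _ _ ua ub → ∥-confluentWrt I₁ I₂
    (confluent⇒confluentWrt W₁ c₁ (urgent-∥⇒urgentˡ I₁ I₂ K ua) (urgent-∥⇒urgentˡ I₁ I₂ K ub))
    (confluent⇒confluentWrt W₂ c₂ (urgent-∥⇒urgentʳ I₁ I₂ K ua) (urgent-∥⇒urgentʳ I₁ I₂ K ub))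
  where open Confluence Act Clk τ
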